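{- Let $k\geq1$ and $n\geq1$. The number of tailed $k$-box paths of size $n$ equals the number of $(k+2)$-ary trees with $n-1$ nodes, which is \[\frac{1}{(k+2)(n-1)+1}\binom{(k+2)(n-1)+1}{n-1};\] for $n\geq2$ this also equals $\frac{1}{n-1}\binom{(k+2)(n-1)}{n-2}$.
   Context: A skew Dyck path is a word $w$ over $\{U,D,L\}$ such that: $w$ contains neither $UL$ nor $LU$ as a contiguous subword; the number of $U$s equals the total number of $D$s and $L$s; and in every prefix the total number of $D$s and $L$s is at most the number of $U$s. Its semilength is its number of $U$s. A factor is a contiguous subword; $X^{m}$ denotes $m$ consecutive copies of $X$. For $k\geq1$, a $k$-box path of size $n$ is a skew Dyck path of semilength $(k+2)n-1$ containing exactly $n$ occurrences of the factor $UD^{k}L$. A tailed $k$-box path is a $k$-box path that ends with the factor $U^{k+1}D^{k}L$. An $m$-ary tree is a rooted tree (possibly empty) in which each node has at most $m$ children, each child being assigned a distinct position among $m$ ordered positions. -}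

module Defs where

open import Data.Bool using (Bool; true; false; _∧_; _∨_; not)
open import Data.Nat using (ℕ; zero; suc; _+_; _*_; _∸_; _≡ᵇ_)
open import Data.List using (List; []; _∷_; length; reverse; replicate; _++_)
open import Data.Vec using (Vec; []; _∷_)
open import Data.Product using (Σ)
open import Relation.Binary.PropositionalEquality using (_≡_)

data Step : Set where
  U D L : Step

_≟ₛ_ : Step → Step → Bool
U ≟ₛ U = true
D ≟ₛ D = true
L ≟ₛ L = true
_ ≟ₛ _ = false

Word : Set
Word = List Step

noULLU : Word → Bool
noULLU [] = true
noULLU (U ∷ L ∷ w) = false
noULLU (L ∷ U ∷ w) = false
noULLU (_ ∷ w) = noULLU w

heightOK : ℕ → Word → Bool
heightOK h [] = h ≡ᵇ 0
heightOK h (U ∷ w) = heightOK (suc h) w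
heightOK zero (D ∷ w) = false
heightOK (suc h) (D ∷ w) = heightOK h w
heightOK zero (L ∷ w) = false
heightOK (suc h) (L ∷ w) = heightOK h w

isSkewDyck : Word → Bool
isSkewDyck w = noULLU w ∧ heightOK 0 w

numU : Word → ℕ
numU [] = 0
numU (U ∷ w) = suc (numU w)
numU (_ ∷ w) = numU w

isPrefix : Word → Word → Bool
isPrefix [] w = true
isPrefix (x ∷ p) [] = false
isPrefix (x ∷ p) (y ∷ w) = (x ≟ₛ y) ∧ isPrefix p w

isSuffix : Word → Word → Bool
isSuffix p w = isPrefix (reverse p) (reverse w)

occurrences : Word → Word → ℕ
occurrences p [] = 0
occurrences p (x ∷ w) with isPrefix p (x ∷ w)
... | true  = suc (occurrences p w)
... | false = occurrences p w

box : ℕ → Word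
box k = U ∷ (replicate k D ++ L ∷ [])

tail : ℕ → Word
tail k = replicate (suc k) U ++ replicate k D ++ L ∷ []

isBoxPath : ℕ → ℕ → Word → Bool
isBoxPath k n w = isSkewDyck w ∧ (numU w ≡ᵇ ((k + 2) * n ∸ 1)) ∧ (occurrences (box k) w ≡ᵇ n)

isTailedBoxPath : ℕ → ℕ → Word → Bool
isTailedBoxPath k n w = isBoxPath k n w ∧ isSuffix (tail k) w

TailedBoxPath : ℕ → ℕ → Set
TailedBoxPath k n = Σ Word (λ w → isTailedBoxPath k n w ≡ true)

data MTree (m : ℕ) : Set where
  empty : MTree m
  node  : Vec (MTree m) m → MTree m

mutual
  nodes : {m : ℕ} → MTree m → ℕ
  nodes empty = 0
  nodes (node ts) = suc (nodesV ts)

  nodesV : {m n : ℕ} → Vec (MTree m) n → ℕ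
  nodesV [] = 0
  nodesV (t ∷ ts) = nodes t + nodesV ts

MTreeOfSize : ℕ → ℕ → Set
MTreeOfSize m s = Σ (MTree m) (λ t → nodes t ≡ s)

module Submission where

-- A tailed k-box path of size m + 1 is rigid. Weighing its letters D and L against its boxes shows
-- that every box but the last is followed by a D, so the path is a word in the blocks U and
-- U D^k L D followed by the tail U^(k+1) D^k L, and the height condition says that these blocks,
-- U raising the height by 1 and U D^k L D lowering it by k + 1, form a walk from 0 back to 0 with
-- m falls. Read backwards, such walks decompose by their last block exactly as forests of
-- (k + 2)-ary trees decompose by their first tree, so both are counted by the same recurrence,
-- whose closed form follows by induction from Pascal's rule and the absorption identity.

open import Defs
open import Axiom.UniquenessOfIdentityProofs using (module Decidable⇒UIP)
open import Data.Bool using (true; false; _∧_)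
open import Data.Bool.Properties using (T-≡; ∧-conicalˡ; ∧-conicalʳ)
import Data.Bool.Properties as Bool
open import Data.Empty using (⊥-elim)
open import Data.Fin using (Fin; zero)
open import Data.Fin.Properties using (+↔⊎)
open import Data.List using (List; []; _∷_; length; replicate; _++_; _∷ʳ_; foldl; reverse)
open import Data.List.Properties
  using (++-assoc; ++-identityʳ; ++-cancelʳ; ∷ʳ-injective; ∷ʳ-injectiveˡ; foldl-++; foldl-∷ʳ; reverse-++; reverse-involutive)
open import Data.Nat using (ℕ; zero; suc; _+_; _*_; _∸_; _≤_; _≡ᵇ_; z≤n; s≤s; s≤s⁻¹)
open import Data.Nat.Combinatorics using (_C_; nC1≡n; nCk+nC[k+1]≡[n+1]C[k+1])
open import Data.Nat.Properties
open import Algebra.Properties.CommutativeSemigroup *-commutativeSemigroup using (x∙yz≈y∙xz)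
open import Data.Nat.Tactic.RingSolver using (solve-∀)
open import Data.Product using (Σ; _×_; _,_; proj₁; proj₂)
open import Data.Sum using (_⊎_; inj₁; inj₂)
open import Data.Sum.Function.Propositional using (_⊎-↔_)
open import Data.Vec using (Vec; []; _∷_; take; drop)
import Data.Vec as Vec
open import Data.Vec.Properties using (take++drop≡id; ++-injective)
open import Function.Bundles using (_↔_; mk↔ₛ′; Equivalence)
open import Function.Properties.Inverse using (↔-trans; ↔-sym)
open import Relation.Binary.PropositionalEquality
open import Relation.Nullary using (Irrelevant)

open ≡-Reasoning

[k+1]*[n+1]C[k+1]≡[n+1]*nCk : ∀ n k → suc k * (suc n C suc k) ≡ suc n * (n C k)
[k+1]*[n+1]C[k+1]≡[n+1]*nCk zero    zero    = refl
[k+1]*[n+1]C[k+1]≡[n+1]*nCk zero    (suc k) = *-zeroʳ (suc (suc k))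
[k+1]*[n+1]C[k+1]≡[n+1]*nCk (suc n) zero    =
  trans (*-identityˡ _) (trans (nC1≡n (suc (suc n))) (sym (*-identityʳ _)))
[k+1]*[n+1]C[k+1]≡[n+1]*nCk (suc n) (suc k) = begin
  suc (suc k) * (suc (suc n) C suc (suc k))
    ≡⟨ cong (suc (suc k) *_) (nCk+nC[k+1]≡[n+1]C[k+1] (suc n) (suc k)) ⟨
  suc (suc k) * (P + suc n C suc (suc k))
    ≡⟨ *-distribˡ-+ (suc (suc k)) P _ ⟩
  (P + suc k * P) + suc (suc k) * (suc n C suc (suc k))
    ≡⟨ cong₂ (λ x y → (P + x) + y) ([k+1]*[n+1]C[k+1]≡[n+1]*nCk n k) ([k+1]*[n+1]C[k+1]≡[n+1]*nCk n (suc k)) ⟩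
  (P + suc n * (n C k)) + suc n * (n C suc k)
    ≡⟨ +-assoc P _ _ ⟩
  P + (suc n * (n C k) + suc n * (n C suc k))
    ≡⟨ cong (P +_) (*-distribˡ-+ (suc n) (n C k) _) ⟨
  P + suc n * (n C k + n C suc k)
    ≡⟨ cong (λ x → P + suc n * x) (nCk+nC[k+1]≡[n+1]C[k+1] n k) ⟩
  suc (suc n) * P ∎
  where P = suc n C suc k

[k+1]*[k+d]C[k+1]≡d*[k+d]Ck : ∀ k d → suc k * ((k + d) C suc k) ≡ d * ((k + d) C k)
[k+1]*[k+d]C[k+1]≡d*[k+d]Ck k d = +-cancelˡ-≡ (suc k * X) _ _ (begin
  suc k * X + suc k * Y        ≡⟨ *-distribˡ-+ (suc k) X Y ⟨
  suc k * (X + Y)              ≡⟨ cong (suc k *_) (nCk+nC[k+1]≡[n+1]C[k+1] (k + d) k) ⟩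
  suc k * (suc (k + d) C suc k) ≡⟨ [k+1]*[n+1]C[k+1]≡[n+1]*nCk (k + d) k ⟩
  suc (k + d) * X              ≡⟨ *-distribʳ-+ X (suc k) d ⟩
  suc k * X + d * X            ∎)
  where
  X = (k + d) C k
  Y = (k + d) C suc k

proj₁-injective : {A : Set} {P : A → Set} → (∀ {x} → Irrelevant (P x)) →
                  {p q : Σ A P} → proj₁ p ≡ proj₁ q → p ≡ q
proj₁-injective irrelevant {x , p} {.x , q} refl = cong (x ,_) (irrelevant p q)

Forest : ℕ → ℕ → ℕ → Set
Forest a s r = Σ (Vec (MTree a) r) λ ts → nodesV ts ≡ s

forests : ℕ → ℕ → ℕ → ℕ
forests a zero    r       = 1
forests a (suc s) zero    = 0
forests a (suc s) (suc r) = forests a (suc s) r + forests a s (a + r)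

module _ {a : ℕ} where

  nodesV-++ : ∀ {m n} (us : Vec (MTree a) m) (ts : Vec (MTree a) n) →
              nodesV (us Vec.++ ts) ≡ nodesV us + nodesV ts
  nodesV-++ []       ts = refl
  nodesV-++ (u ∷ us) ts = trans (cong (nodes u +_) (nodesV-++ us ts)) (sym (+-assoc (nodes u) _ _))

  nodesV-replicate-empty : ∀ r → nodesV (Vec.replicate r (empty {a})) ≡ 0
  nodesV-replicate-empty zero    = refl
  nodesV-replicate-empty (suc r) = nodesV-replicate-empty r

  nodesV≡0⇒replicate-empty : ∀ {r} (ts : Vec (MTree a) r) → nodesV ts ≡ 0 → ts ≡ Vec.replicate r empty
  nodesV≡0⇒replicate-empty []            _ = refl
  nodesV≡0⇒replicate-empty (empty ∷ ts)  p = cong (empty ∷_) (nodesV≡0⇒replicate-empty ts p)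

  forest-≡ : ∀ {s r} {f g : Forest a s r} → proj₁ f ≡ proj₁ g → f ≡ g
  forest-≡ = proj₁-injective ≡-irrelevant

  forest-nodeless-↔ : ∀ r → Forest a 0 r ↔ Fin 1
  forest-nodeless-↔ r = mk↔ₛ′ (λ _ → zero) (λ _ → Vec.replicate r empty , nodesV-replicate-empty r)
    (λ { zero → refl }) (λ (ts , p) → forest-≡ (sym (nodesV≡0⇒replicate-empty ts p)))

  forest-treeless-↔ : ∀ s → Forest a (suc s) 0 ↔ Fin 0
  forest-treeless-↔ s = mk↔ₛ′ (λ { ([] , ()) }) (λ ()) (λ ()) (λ { ([] , ()) })

  forest-first-tree-↔ : ∀ s r → Forest a (suc s) (suc r) ↔ (Forest a (suc s) r ⊎ Forest a s (a + r))
  forest-first-tree-↔ s r = mk↔ₛ′ to from to∘from from∘to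
    where
    to : Forest a (suc s) (suc r) → Forest a (suc s) r ⊎ Forest a s (a + r)
    to (empty   ∷ ts , p) = inj₁ (ts , p)
    to (node us ∷ ts , p) = inj₂ (us Vec.++ ts , trans (nodesV-++ us ts) (suc-injective p))

    from : Forest a (suc s) r ⊎ Forest a s (a + r) → Forest a (suc s) (suc r)
    from (inj₁ (ts , p)) = empty ∷ ts , p
    from (inj₂ (vs , q)) = node (take a vs) ∷ drop a vs ,
      cong suc (trans (sym (nodesV-++ (take a vs) (drop a vs))) (trans (cong nodesV (take++drop≡id a vs)) q))

    to∘from : ∀ y → to (from y) ≡ y
    to∘from (inj₁ _)       = refl
    to∘from (inj₂ (vs , _)) = cong inj₂ (forest-≡ (take++drop≡id a vs))

    from∘to : ∀ x → from (to x) ≡ x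
    from∘to (empty   ∷ ts , p) = refl
    from∘to (node us ∷ ts , p) = forest-≡ (cong₂ (λ vs ws → node vs ∷ ws) take≡ drop≡)
      where
      split = ++-injective (take a (us Vec.++ ts)) us (take++drop≡id a (us Vec.++ ts))
      take≡ = proj₁ split
      drop≡ = proj₂ split

  forest-↔ : ∀ s r → Forest a s r ↔ Fin (forests a s r)
  forest-↔ zero    r       = forest-nodeless-↔ r
  forest-↔ (suc s) zero    = forest-treeless-↔ s
  forest-↔ (suc s) (suc r) = ↔-trans (forest-first-tree-↔ s r)
    (↔-trans (forest-↔ (suc s) r ⊎-↔ forest-↔ s (a + r)) (↔-sym +↔⊎))

  tree-↔ : ∀ s → MTreeOfSize a s ↔ Fin (forests a s 1)
  tree-↔ s = ↔-trans (mk↔ₛ′ to from to∘from from∘to) (forest-↔ s 1)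
    where
    to : MTreeOfSize a s → Forest a s 1
    to (t , p) = t ∷ [] , trans (+-identityʳ _) p
    from : Forest a s 1 → MTreeOfSize a s
    from (t ∷ [] , p) = t , trans (sym (+-identityʳ _)) p
    to∘from : ∀ f → to (from f) ≡ f
    to∘from (t ∷ [] , p) = forest-≡ refl
    from∘to : ∀ t → from (to t) ≡ t
    from∘to (t , p) = cong (t ,_) (≡-irrelevant _ _)

forests-closed-step : ∀ b s r → let a = suc b; A = a * suc s + r in
  forests a (suc s) r * A ≡ r * (A C suc s) →
  forests a s (a + r) * (a * s + (a + r)) ≡ (a + r) * ((a * s + (a + r)) C s) →
  forests a (suc s) (suc r) * (a * suc s + suc r) ≡ suc r * ((a * suc s + suc r) C suc s)
forests-closed-step b s r IH₁ IH₂ = begin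
  (F₁ + F₂) * (a * suc s + suc r)   ≡⟨ cong ((F₁ + F₂) *_) (+-suc (a * suc s) r) ⟩
  (F₁ + F₂) * suc A                 ≡⟨ *-cancelˡ-≡ _ _ (suc s * A) {{m*n≢0 (suc s) A}} multiplied ⟩
  suc r * (suc A C suc s)           ≡⟨ cong (λ n → suc r * (n C suc s)) (+-suc (a * suc s) r) ⟨
  suc r * ((a * suc s + suc r) C suc s) ∎
  where
  a = suc b
  A = a * suc s + r
  X = A C s
  Y = A C suc s
  F₁ = forests a (suc s) r
  F₂ = forests a s (a + r)

  IH₂′ : F₂ * A ≡ (a + r) * X
  IH₂′ = subst (λ n → F₂ * n ≡ (a + r) * (n C s)) (shift b s r) IH₂
    where
    shift : ∀ b s r → suc b * s + (suc b + r) ≡ suc b * suc s + r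
    shift = solve-∀

  sY : suc s * Y ≡ (b * suc s + suc r) * X
  sY = subst (λ n → suc s * (n C suc s) ≡ (b * suc s + suc r) * (n C s)) (split b s r)
             ([k+1]*[k+d]C[k+1]≡d*[k+d]Ck s (b * suc s + suc r))
    where
    split : ∀ b s r → s + (b * suc s + suc r) ≡ suc b * suc s + r
    split = solve-∀

  multiplied : suc s * A * ((F₁ + F₂) * suc A) ≡ suc s * A * (suc r * (suc A C suc s))
  multiplied = begin
    suc s * A * ((F₁ + F₂) * suc A)
      ≡⟨ distribute (suc s) A (suc A) F₁ F₂ ⟩
    suc A * (suc s * (F₁ * A) + suc s * (F₂ * A))
      ≡⟨ cong₂ (λ x y → suc A * (suc s * x + suc s * y)) IH₁ IH₂′ ⟩
    suc A * (suc s * (r * Y) + suc s * ((a + r) * X))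
      ≡⟨ cong (λ y → suc A * (y + suc s * ((a + r) * X))) (trans (x∙yz≈y∙xz (suc s) r Y) (cong (r *_) sY)) ⟩
    suc A * (r * ((b * suc s + suc r) * X) + suc s * ((a + r) * X))
      ≡⟨ collect b s r X ⟩
    A * suc r * (suc A * X)
      ≡⟨ cong (A * suc r *_) ([k+1]*[n+1]C[k+1]≡[n+1]*nCk A s) ⟨
    A * suc r * (suc s * (suc A C suc s))
      ≡⟨ rearrange (suc s) A (suc r) (suc A C suc s) ⟩
    suc s * A * (suc r * (suc A C suc s)) ∎
    where
    distribute : ∀ s A A' F₁ F₂ → s * A * ((F₁ + F₂) * A') ≡ A' * (s * (F₁ * A) + s * (F₂ * A))
    distribute = solve-∀
    collect : ∀ b s r X → suc (suc b * suc s + r) * (r * ((b * suc s + suc r) * X) + suc s * ((suc b + r) * X))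
                          ≡ (suc b * suc s + r) * suc r * (suc (suc b * suc s + r) * X)
    collect = solve-∀
    rearrange : ∀ s A r Z → A * r * (s * Z) ≡ s * A * (r * Z)
    rearrange = solve-∀

forests-closed : ∀ b s r → forests (suc b) s r * (suc b * s + r) ≡ r * ((suc b * s + r) C s)
forests-closed b zero    r       = base b r
  where
  base : ∀ b r → 1 * (suc b * 0 + r) ≡ r * 1
  base = solve-∀
forests-closed b (suc s) zero    = refl
forests-closed b (suc s) (suc r) =
  forests-closed-step b s r (forests-closed b (suc s) r) (forests-closed b s (suc b + r))

forests-closed-pred : ∀ b {m} → 1 ≤ m → forests (suc b) m 1 * m ≡ (suc b * m) C (m ∸ 1)
forests-closed-pred b {suc s} _ = *-cancelˡ-≡ _ _ (suc B) (begin
  suc B * (F * suc s)          ≡⟨ rearrange B F s ⟩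
  suc s * (F * (B + 1))        ≡⟨ cong (suc s *_) (trans (forests-closed b (suc s) 1) (*-identityˡ _)) ⟩
  suc s * ((B + 1) C suc s)    ≡⟨ cong (λ n → suc s * (n C suc s)) (+-comm B 1) ⟩
  suc s * (suc B C suc s)      ≡⟨ [k+1]*[n+1]C[k+1]≡[n+1]*nCk B s ⟩
  suc B * (B C s)              ∎)
  where
  B = suc b * suc s
  F = forests (suc b) (suc s) 1
  rearrange : ∀ B F s → suc B * (F * suc s) ≡ suc s * (F * (B + 1))
  rearrange = solve-∀

replicate-++-∷ : ∀ {A : Set} n (x : A) xs → replicate n x ++ x ∷ xs ≡ x ∷ replicate n x ++ xs
replicate-++-∷ zero    x xs = refl
replicate-++-∷ (suc n) x xs = cong (x ∷_) (replicate-++-∷ n x xs)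

[]≢∷ʳ : ∀ {A : Set} (xs : List A) x → [] ≢ xs ∷ʳ x
[]≢∷ʳ []      _ ()
[]≢∷ʳ (_ ∷ _) _ ()

≟ₛ⇒≡ : ∀ x y → (x ≟ₛ y) ≡ true → x ≡ y
≟ₛ⇒≡ U U _ = refl
≟ₛ⇒≡ D D _ = refl
≟ₛ⇒≡ L L _ = refl

isPrefix-++ : ∀ p w → isPrefix p (p ++ w) ≡ true
isPrefix-++ []      w = refl
isPrefix-++ (U ∷ p) w = isPrefix-++ p w
isPrefix-++ (D ∷ p) w = isPrefix-++ p w
isPrefix-++ (L ∷ p) w = isPrefix-++ p w

isPrefix⇒++ : ∀ p w → isPrefix p w ≡ true → Σ Word λ q → w ≡ p ++ q
isPrefix⇒++ []      w       _ = w , refl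
isPrefix⇒++ (x ∷ p) (y ∷ w) e
  with refl ← ≟ₛ⇒≡ x y (∧-conicalˡ (x ≟ₛ y) _ e)
     | q , refl ← isPrefix⇒++ p w (∧-conicalʳ (x ≟ₛ y) _ e) = q , refl

isSuffix-++ : ∀ p q → isSuffix p (q ++ p) ≡ true
isSuffix-++ p q = subst (λ w → isPrefix (reverse p) w ≡ true) (sym (reverse-++ q p)) (isPrefix-++ (reverse p) (reverse q))

isSuffix⇒++ : ∀ p w → isSuffix p w ≡ true → Σ Word λ q → w ≡ q ++ p
isSuffix⇒++ p w e with q , eq ← isPrefix⇒++ (reverse p) (reverse w) e = reverse q , (begin
  w                             ≡⟨ reverse-involutive w ⟨
  reverse (reverse w)           ≡⟨ cong reverse eq ⟩
  reverse (reverse p ++ q)      ≡⟨ reverse-++ (reverse p) q ⟩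
  reverse q ++ reverse (reverse p) ≡⟨ cong (reverse q ++_) (reverse-involutive p) ⟩
  reverse q ++ p                ∎)

noULLU-∷ : ∀ x w → noULLU (x ∷ w) ≡ true → noULLU w ≡ true
noULLU-∷ U []      _ = refl
noULLU-∷ U (U ∷ w) e = e
noULLU-∷ U (D ∷ w) e = e
noULLU-∷ D w       e = e
noULLU-∷ L []      _ = refl
noULLU-∷ L (D ∷ w) e = e
noULLU-∷ L (L ∷ w) e = e

noULLU-replicate-D : ∀ j w → noULLU (replicate j D ++ w) ≡ noULLU w
noULLU-replicate-D zero    w = refl
noULLU-replicate-D (suc j) w = noULLU-replicate-D j w

numU-replicate-U : ∀ j w → numU (replicate j U ++ w) ≡ j + numU w
numU-replicate-U zero    w = refl
numU-replicate-U (suc j) w = cong suc (numU-replicate-U j w)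

numU-replicate-D : ∀ j w → numU (replicate j D ++ w) ≡ numU w
numU-replicate-D zero    w = refl
numU-replicate-D (suc j) w = numU-replicate-D j w

heightOK-replicate-U : ∀ j h w → heightOK h (replicate j U ++ w) ≡ heightOK (j + h) w
heightOK-replicate-U zero    h w = refl
heightOK-replicate-U (suc j) h w = trans (heightOK-replicate-U j (suc h) w) (cong (λ h → heightOK h w) (+-suc j h))

heightOK-replicate-D : ∀ j h w → heightOK (j + h) (replicate j D ++ w) ≡ heightOK h w
heightOK-replicate-D zero    h w = refl
heightOK-replicate-D (suc j) h w = heightOK-replicate-D j h w

heightOK-DLD : ∀ j h w → heightOK (suc (suc j + h)) (replicate j D ++ L ∷ D ∷ w) ≡ heightOK h w
heightOK-DLD zero    h w = refl
heightOK-DLD (suc j) h w = heightOK-DLD j h w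

heightOK-DLD⁻¹ : ∀ j h w → heightOK (suc h) (replicate j D ++ L ∷ D ∷ w) ≡ true →
                 Σ ℕ λ h′ → h ≡ suc j + h′ × heightOK h′ w ≡ true
heightOK-DLD⁻¹ zero          zero    w ()
heightOK-DLD⁻¹ zero          (suc h) w e = h , refl , e
heightOK-DLD⁻¹ (suc zero)    zero    w ()
heightOK-DLD⁻¹ (suc (suc j)) zero    w ()
heightOK-DLD⁻¹ (suc j)       (suc h) w e with h′ , refl , e′ ← heightOK-DLD⁻¹ j h w e = h′ , refl , e′

numDL : Word → ℕ
numDL []      = 0
numDL (U ∷ w) = numDL w
numDL (_ ∷ w) = suc (numDL w)

heightOK⇒numU+h≡numDL : ∀ h w → heightOK h w ≡ true → numU w + h ≡ numDL w
heightOK⇒numU+h≡numDL h       []      e = ≡ᵇ⇒≡ h 0 (Equivalence.from T-≡ e)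
heightOK⇒numU+h≡numDL h       (U ∷ w) e = trans (sym (+-suc (numU w) h)) (heightOK⇒numU+h≡numDL (suc h) w e)
heightOK⇒numU+h≡numDL (suc h) (D ∷ w) e = trans (+-suc (numU w) h) (cong suc (heightOK⇒numU+h≡numDL h w e))
heightOK⇒numU+h≡numDL (suc h) (L ∷ w) e = trans (+-suc (numU w) h) (cong suc (heightOK⇒numU+h≡numDL h w e))

-- k ≥ 1 is needed: for k = 0 the box U L cannot occur in a skew Dyck path.
module BoxPaths (k-1 : ℕ) where

  k : ℕ
  k = suc k-1

  data Move : Set where
    rise fall : Move

  boxed : Word → Word
  boxed w = U ∷ replicate k D ++ L ∷ w

  _⊲_ : Word → Move → Word
  w ⊲ rise = U ∷ w
  w ⊲ fall = boxed (D ∷ w)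

  -- The moves are listed from the last to the first.
  render : List Move → Word → Word
  render u w = foldl _⊲_ w u

  render-∷ʳ : ∀ u x w → render (u ∷ʳ x) w ≡ render u w ⊲ x
  render-∷ʳ u x w = foldl-∷ʳ _⊲_ w x u

  render-++ : ∀ u v w → render (u ++ v) w ≡ render v (render u w)
  render-++ u v w = foldl-++ _⊲_ w u v

  render-rises : ∀ j w → render (replicate j rise) w ≡ replicate j U ++ w
  render-rises zero    w = refl
  render-rises (suc j) w = trans (render-rises j (U ∷ w)) (replicate-++-∷ j U w)

  tail≡render : tail k ≡ render (replicate k rise) (box k)
  tail≡render = sym (trans (render-rises k (box k)) (replicate-++-∷ k U _))

  []⊲-++ : ∀ x w → ([] ⊲ x) ++ w ≡ w ⊲ x
  []⊲-++ rise w = refl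
  []⊲-++ fall w = cong (U ∷_) (++-assoc (replicate k D) (L ∷ D ∷ []) w)

  render≡render[]++ : ∀ u w → render u w ≡ render u [] ++ w
  render≡render[]++ []      w = refl
  render≡render[]++ (x ∷ u) w = begin
    render u (w ⊲ x)                ≡⟨ render≡render[]++ u (w ⊲ x) ⟩
    render u [] ++ (w ⊲ x)          ≡⟨ cong (render u [] ++_) ([]⊲-++ x w) ⟨
    render u [] ++ ([] ⊲ x) ++ w    ≡⟨ ++-assoc (render u []) ([] ⊲ x) w ⟨
    (render u [] ++ ([] ⊲ x)) ++ w  ≡⟨ cong (_++ w) (render≡render[]++ u ([] ⊲ x)) ⟨
    render u ([] ⊲ x) ++ w          ∎

  render-rise : ∀ u → render (rise ∷ u) [] ≡ render u [] ∷ʳ U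
  render-rise u = render≡render[]++ u (U ∷ [])

  render-fall : ∀ u → render (fall ∷ u) [] ≡ (render u [] ++ box k) ∷ʳ D
  render-fall u = begin
    render u (boxed (D ∷ []))                 ≡⟨ render≡render[]++ u _ ⟩
    render u [] ++ boxed (D ∷ [])             ≡⟨ cong (λ v → render u [] ++ U ∷ v) (++-assoc (replicate k D) (L ∷ []) (D ∷ [])) ⟨
    render u [] ++ (box k ∷ʳ D)               ≡⟨ ++-assoc (render u []) (box k) (D ∷ []) ⟨
    (render u [] ++ box k) ∷ʳ D               ∎

  render[]-injective : ∀ u v → render u [] ≡ render v [] → u ≡ v
  render[]-injective []         []         _ = refl
  render[]-injective []         (rise ∷ v) e = ⊥-elim ([]≢∷ʳ _ _ (trans e (render-rise v)))
  render[]-injective []         (fall ∷ v) e = ⊥-elim ([]≢∷ʳ _ _ (trans e (render-fall v)))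
  render[]-injective (rise ∷ u) []         e = ⊥-elim ([]≢∷ʳ _ _ (trans (sym e) (render-rise u)))
  render[]-injective (fall ∷ u) []         e = ⊥-elim ([]≢∷ʳ _ _ (trans (sym e) (render-fall u)))
  render[]-injective (rise ∷ u) (rise ∷ v) e =
    cong (rise ∷_) (render[]-injective u v (∷ʳ-injectiveˡ _ _ (trans (sym (render-rise u)) (trans e (render-rise v)))))
  render[]-injective (fall ∷ u) (fall ∷ v) e = cong (fall ∷_) (render[]-injective u v
    (++-cancelʳ (box k) _ _ (∷ʳ-injectiveˡ _ _ (trans (sym (render-fall u)) (trans e (render-fall v))))))
  render[]-injective (rise ∷ u) (fall ∷ v) e
    with () ← proj₂ (∷ʳ-injective _ _ (trans (sym (render-rise u)) (trans e (render-fall v))))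
  render[]-injective (fall ∷ u) (rise ∷ v) e
    with () ← proj₂ (∷ʳ-injective _ _ (trans (sym (render-fall u)) (trans e (render-rise v))))

  render-injective : ∀ u v w → render u w ≡ render v w → u ≡ v
  render-injective u v w e =
    render[]-injective u v (++-cancelʳ w _ _ (trans (sym (render≡render[]++ u w)) (trans e (render≡render[]++ v w))))

  render[]≡++U⇒rises : ∀ j u q → render u [] ≡ q ++ replicate j U → Σ (List Move) λ v → u ≡ replicate j rise ++ v
  render[]≡++U⇒rises zero    u q e = u , refl
  render[]≡++U⇒rises (suc j) u q e = go u (trans e (sym qU))
    where
    qU : (q ++ replicate j U) ∷ʳ U ≡ q ++ replicate (suc j) U
    qU = trans (++-assoc q _ _) (cong (q ++_) (trans (replicate-++-∷ j U []) (cong (U ∷_) (++-identityʳ _))))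
    go : ∀ u → render u [] ≡ (q ++ replicate j U) ∷ʳ U → Σ (List Move) λ v → u ≡ replicate (suc j) rise ++ v
    go []         e = ⊥-elim ([]≢∷ʳ _ _ e)
    go (rise ∷ u) e with v , refl ← render[]≡++U⇒rises j u q (∷ʳ-injectiveˡ _ _ (trans (sym (render-rise u)) e)) = v , refl
    go (fall ∷ u) e with () ← proj₂ (∷ʳ-injective _ _ (trans (sym (render-fall u)) e))

  occ : Word → ℕ
  occ = occurrences (box k)

  occ-replicate-D : ∀ j w → occ (replicate j D ++ w) ≡ occ w
  occ-replicate-D zero    w = refl
  occ-replicate-D (suc j) w = occ-replicate-D j w

  isPrefix-DL : ∀ j w → isPrefix (replicate j D ++ L ∷ []) (replicate j D ++ L ∷ w) ≡ true
  isPrefix-DL zero    w = refl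
  isPrefix-DL (suc j) w = isPrefix-DL j w

  occ-boxed : ∀ w → occ (boxed w) ≡ suc (occ w)
  occ-boxed w rewrite isPrefix-DL k w = cong suc (occ-replicate-D k (L ∷ w))

  -- A box owns its k + 1 letters D, L and, unless it ends the word, the letter after it,
  -- which cannot be U (no L U) and so lies in no box.
  mutual
    occ-bound : ∀ w → noULLU w ≡ true → occ w * (2 + k) ≤ suc (numDL w)
    occ-bound []      _ = z≤n
    occ-bound (D ∷ w) p = m≤n⇒m≤1+n (occ-bound w p)
    occ-bound (L ∷ w) p = m≤n⇒m≤1+n (occ-bound w (noULLU-∷ L w p))
    occ-bound (U ∷ w) p with isPrefix (box k) (U ∷ w) in e
    ... | false = occ-bound w (noULLU-∷ U w p)
    ... | true  = occ-bound-box k w e (noULLU-∷ U w p)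

    occ-bound-after-L : ∀ w → noULLU (L ∷ w) ≡ true → occ w * (2 + k) ≤ numDL w
    occ-bound-after-L []      _ = z≤n
    occ-bound-after-L (D ∷ w) p = occ-bound w p
    occ-bound-after-L (L ∷ w) p = occ-bound w (noULLU-∷ L w p)

    occ-bound-box : ∀ j w → isPrefix (replicate j D ++ L ∷ []) w ≡ true → noULLU w ≡ true →
                    suc (suc j) + occ w * (2 + k) ≤ suc (numDL w)
    occ-bound-box zero    (L ∷ w) _ p = s≤s (s≤s (occ-bound-after-L w p))
    occ-bound-box (suc j) (D ∷ w) e p = s≤s (occ-bound-box j w e p)

  IsCanonical : Word → Set
  IsCanonical w = Σ (List Move) λ u → w ≡ render u (box k)

  mutual
    canonical : ∀ w → noULLU w ≡ true → occ w * (2 + k) ≡ suc (numDL w) → IsCanonical w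
    canonical (D ∷ w) p e = ⊥-elim (1+n≰n (subst (_≤ suc (numDL w)) e (occ-bound w p)))
    canonical (L ∷ w) p e = ⊥-elim (1+n≰n (subst (_≤ suc (numDL w)) e (occ-bound w (noULLU-∷ L w p))))
    canonical (U ∷ w) p e with isPrefix (box k) (U ∷ w) in b
    ... | false with u , refl ← canonical w (noULLU-∷ U w p) e = u ∷ʳ rise , sym (render-∷ʳ u rise (box k))
    ... | true with canonical-box k w b (noULLU-∷ U w p) e
    ...   | ._ , refl , inj₁ refl        = [] , refl
    ...   | ._ , refl , inj₂ (u , refl)  = u ∷ʳ fall , sym (render-∷ʳ u fall (box k))

    canonical-box : ∀ j w → isPrefix (replicate j D ++ L ∷ []) w ≡ true → noULLU w ≡ true →
                    suc (suc j) + occ w * (2 + k) ≡ suc (numDL w) →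
                    Σ Word λ r → w ≡ replicate j D ++ L ∷ r × (r ≡ [] ⊎ Σ (List Move) λ u → r ≡ D ∷ render u (box k))
    canonical-box zero    (L ∷ [])     _ _ _ = [] , refl , inj₁ refl
    canonical-box zero    (L ∷ L ∷ w)  _ p e =
      ⊥-elim (1+n≰n (subst (_≤ numDL w) (suc-injective (suc-injective e)) (occ-bound-after-L w p)))
    canonical-box zero    (L ∷ D ∷ w)  _ p e with u , refl ← canonical w p (suc-injective (suc-injective e)) =
      D ∷ render u (box k) , refl , inj₂ (u , refl)
    canonical-box (suc j) (D ∷ w)      b p e with r , refl , end ← canonical-box j w b p (suc-injective e) =
      r , refl , end

  canonical-tailed : ∀ w → noULLU w ≡ true → occ w * (2 + k) ≡ suc (numDL w) → isSuffix (tail k) w ≡ true →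
                     Σ (List Move) λ u → w ≡ render u (tail k)
  canonical-tailed w p e s with u₀ , refl ← canonical w p e | q , ends ← isSuffix⇒++ (tail k) w s
    with v , refl ← render[]≡++U⇒rises k u₀ q (++-cancelʳ (box k) _ _ (begin
           render u₀ [] ++ box k             ≡⟨ render≡render[]++ u₀ (box k) ⟨
           render u₀ (box k)                 ≡⟨ ends ⟩
           q ++ tail k                       ≡⟨ cong (q ++_) (replicate-++-∷ k U _) ⟨
           q ++ replicate k U ++ box k       ≡⟨ ++-assoc q _ _ ⟨
           (q ++ replicate k U) ++ box k     ∎))
    = v , trans (render-++ (replicate k rise) v (box k)) (cong (render v) (sym tail≡render))

  data Reach : ℕ → List Move → ℕ → Set where
    start      : Reach 0 [] 0
    after-rise : ∀ {j u h} → Reach j u h → Reach j (rise ∷ u) (suc h)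
    after-fall : ∀ {j u h} → Reach j u (suc k + h) → Reach (suc j) (fall ∷ u) h

  Reaching : ℕ → ℕ → Set
  Reaching j h = Σ (List Move) λ u → Reach j u h

  Reach-irrelevant : ∀ {j u h} (r r′ : Reach j u h) → r ≡ r′
  Reach-irrelevant start          start           = refl
  Reach-irrelevant (after-rise r) (after-rise r′) = cong after-rise (Reach-irrelevant r r′)
  Reach-irrelevant (after-fall r) (after-fall r′) = cong after-fall (Reach-irrelevant r r′)

  Reach-rises : ∀ j → Reach 0 (replicate j rise) j
  Reach-rises zero    = start
  Reach-rises (suc j) = after-rise (Reach-rises j)

  heightOK-render⁻¹ : ∀ u w → heightOK 0 (render u w) ≡ true → Σ ℕ λ j → Σ ℕ λ h → Reach j u h × heightOK h w ≡ true
  heightOK-render⁻¹ []         w e = 0 , 0 , start , e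
  heightOK-render⁻¹ (rise ∷ u) w e with j , h , r , e′ ← heightOK-render⁻¹ u (U ∷ w) e = j , suc h , after-rise r , e′
  heightOK-render⁻¹ (fall ∷ u) w e with j , h , r , e′ ← heightOK-render⁻¹ u (w ⊲ fall) e
    with h′ , refl , e″ ← heightOK-DLD⁻¹ k h w e′ = suc j , h′ , after-fall r , e″

  heightOK-render : ∀ {j u h} w → Reach j u h → heightOK h w ≡ true → heightOK 0 (render u w) ≡ true
  heightOK-render w start          e = e
  heightOK-render w (after-rise r) e = heightOK-render (U ∷ w) r e
  heightOK-render w (after-fall {h = h} r) e = heightOK-render (w ⊲ fall) r (trans (heightOK-DLD k h w) e)

  heightOK-tail : ∀ h → heightOK h (tail k) ≡ (h ≡ᵇ 0)
  heightOK-tail h = begin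
    heightOK h (tail k)                                 ≡⟨ heightOK-replicate-U (suc k) h _ ⟩
    heightOK (suc k + h) (replicate k D ++ L ∷ [])      ≡⟨ cong (λ n → heightOK n (replicate k D ++ L ∷ [])) (+-suc k h) ⟨
    heightOK (k + suc h) (replicate k D ++ L ∷ [])      ≡⟨ heightOK-replicate-D k (suc h) (L ∷ []) ⟩
    (h ≡ᵇ 0)                                            ∎

  Reach-length : ∀ {j u h} → Reach j u h → length u ≡ h + (2 + k) * j
  Reach-length start          = sym (*-zeroʳ (2 + k))
  Reach-length (after-rise r) = cong suc (Reach-length r)
  Reach-length (after-fall {j = j} {h = h} r) = trans (cong suc (Reach-length r)) (fall-length k h j)
    where
    fall-length : ∀ k h j → suc (suc k + h + (2 + k) * j) ≡ h + (2 + k) * suc j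
    fall-length = solve-∀

  numU-render : ∀ u w → numU (render u w) ≡ length u + numU w
  numU-render []         w = refl
  numU-render (rise ∷ u) w = trans (numU-render u (U ∷ w)) (+-suc (length u) (numU w))
  numU-render (fall ∷ u) w = begin
    numU (render u (w ⊲ fall))                   ≡⟨ numU-render u (w ⊲ fall) ⟩
    length u + suc (numU (replicate k D ++ _))   ≡⟨ cong (λ n → length u + suc n) (numU-replicate-D k (L ∷ D ∷ w)) ⟩
    length u + suc (numU w)                      ≡⟨ +-suc (length u) (numU w) ⟩
    suc (length u + numU w)                      ∎

  numU-tail : numU (tail k) ≡ suc k
  numU-tail = trans (numU-replicate-U (suc k) _) (trans (cong (suc k +_) (numU-replicate-D k (L ∷ []))) (+-identityʳ (suc k)))

  occ-render : ∀ {j u h} Y → Reach j u h → occ (render u (U ∷ Y)) ≡ j + occ (U ∷ Y)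
  occ-render Y start          = refl
  occ-render Y (after-rise r) = occ-render (U ∷ Y) r
  occ-render {suc j} {fall ∷ u} Y (after-fall r) = begin
    occ (render u (boxed (D ∷ U ∷ Y)))   ≡⟨ occ-render (replicate k D ++ L ∷ D ∷ U ∷ Y) r ⟩
    j + occ (boxed (D ∷ U ∷ Y))          ≡⟨ cong (j +_) (occ-boxed (D ∷ U ∷ Y)) ⟩
    j + suc (occ (U ∷ Y))                ≡⟨ +-suc j _ ⟩
    suc j + occ (U ∷ Y)                  ∎

  occ-tail : occ (tail k) ≡ 1
  occ-tail = begin
    occ (tail k)                               ≡⟨ cong occ tail≡render ⟩
    occ (render (replicate k rise) (box k))    ≡⟨ occ-render (replicate k D ++ L ∷ []) (Reach-rises k) ⟩
    occ (box k)                                ≡⟨ occ-boxed [] ⟩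
    1                                          ∎

  noULLU-render : ∀ u Y → noULLU (render u (U ∷ Y)) ≡ noULLU (U ∷ Y)
  noULLU-render []         Y = refl
  noULLU-render (rise ∷ u) Y = noULLU-render u (U ∷ Y)
  noULLU-render (fall ∷ u) Y =
    trans (noULLU-render u (replicate k D ++ L ∷ D ∷ U ∷ Y)) (noULLU-replicate-D k-1 (L ∷ D ∷ U ∷ Y))

  noULLU-tail : noULLU (tail k) ≡ true
  noULLU-tail = trans (cong noULLU tail≡render)
    (trans (noULLU-render (replicate k rise) (replicate k D ++ L ∷ [])) (noULLU-replicate-D k-1 (L ∷ [])))

  record IsTailed (n : ℕ) (w : Word) : Set where
    field
      ul-free    : noULLU w ≡ true
      balanced   : heightOK 0 w ≡ true
      semilength : numU w ≡ (k + 2) * n ∸ 1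
      boxes      : occ w ≡ n
      tailed     : isSuffix (tail k) w ≡ true

  isTailedBoxPath⇒IsTailed : ∀ n w → isTailedBoxPath k n w ≡ true → IsTailed n w
  isTailedBoxPath⇒IsTailed n w e = record
    { ul-free    = ∧-conicalˡ _ _ skew
    ; balanced   = ∧-conicalʳ _ _ skew
    ; semilength = ≡ᵇ⇒≡ _ _ (Equivalence.from T-≡ (∧-conicalˡ _ _ counts))
    ; boxes      = ≡ᵇ⇒≡ _ _ (Equivalence.from T-≡ (∧-conicalʳ _ _ counts))
    ; tailed     = ∧-conicalʳ _ _ e
    }
    where
    boxPath = ∧-conicalˡ (isBoxPath k n w) _ e
    skew    = ∧-conicalˡ (isSkewDyck w) _ boxPath
    counts  = ∧-conicalʳ (isSkewDyck w) _ boxPath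

  IsTailed⇒isTailedBoxPath : ∀ n w → IsTailed n w → isTailedBoxPath k n w ≡ true
  IsTailed⇒isTailedBoxPath n w t = cong₂ _∧_ (cong₂ _∧_ (cong₂ _∧_ ul-free balanced)
    (cong₂ _∧_ (Equivalence.to T-≡ (≡⇒≡ᵇ _ _ semilength)) (Equivalence.to T-≡ (≡⇒≡ᵇ _ _ boxes)))) tailed
    where open IsTailed t

  semilength-arith : ∀ m → (k + 2) * suc m ≡ suc ((2 + k) * m + suc k)
  semilength-arith m = arith k m
    where
    arith : ∀ k m → (k + 2) * suc m ≡ suc ((2 + k) * m + suc k)
    arith = solve-∀

  render-IsTailed : ∀ {m u} → Reach m u 0 → IsTailed (suc m) (render u (tail k))
  render-IsTailed {m} {u} r = record
    { ul-free    = trans (noULLU-render u _) noULLU-tail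
    ; balanced   = heightOK-render (tail k) r (heightOK-tail 0)
    ; semilength = begin
        numU (render u (tail k))     ≡⟨ numU-render u (tail k) ⟩
        length u + numU (tail k)     ≡⟨ cong₂ _+_ (Reach-length r) numU-tail ⟩
        (2 + k) * m + suc k          ≡⟨ cong (_∸ 1) (semilength-arith m) ⟨
        (k + 2) * suc m ∸ 1          ∎
    ; boxes      = trans (occ-render _ r) (trans (cong (m +_) occ-tail) (+-comm m 1))
    ; tailed     = subst (λ v → isSuffix (tail k) v ≡ true) (sym (render≡render[]++ u (tail k))) (isSuffix-++ (tail k) (render u []))
    }

  IsTailed⇒occ-numDL : ∀ m w → IsTailed (suc m) w → occ w * (2 + k) ≡ suc (numDL w)
  IsTailed⇒occ-numDL m w t = begin
    occ w * (2 + k)               ≡⟨ cong (_* (2 + k)) boxes ⟩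
    suc m * (2 + k)               ≡⟨ *-comm (suc m) (2 + k) ⟩
    (2 + k) * suc m               ≡⟨ cong (_* suc m) (+-comm 2 k) ⟩
    (k + 2) * suc m               ≡⟨ suc-pred ((k + 2) * suc m) ⟨
    suc ((k + 2) * suc m ∸ 1)     ≡⟨ cong suc semilength ⟨
    suc (numU w)                  ≡⟨ cong suc (trans (sym (+-identityʳ (numU w))) (heightOK⇒numU+h≡numDL 0 w balanced)) ⟩
    suc (numDL w)                 ∎
    where open IsTailed t

  IsTailed⇒render : ∀ m w → IsTailed (suc m) w → Σ (List Move) λ u → Reach m u 0 × w ≡ render u (tail k)
  IsTailed⇒render m w t
    with u , refl ← canonical-tailed w (IsTailed.ul-free t) (IsTailed⇒occ-numDL m w t) (IsTailed.tailed t)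
    with j , h , r , e ← heightOK-render⁻¹ u (tail k) (IsTailed.balanced t)
    with refl ← ≡ᵇ⇒≡ h 0 (Equivalence.from T-≡ (trans (sym (heightOK-tail h)) e))
       | refl ← suc-injective (begin
           suc j                           ≡⟨ +-comm 1 j ⟩
           j + 1                           ≡⟨ cong (j +_) occ-tail ⟨
           j + occ (tail k)                ≡⟨ occ-render _ r ⟨
           occ (render u (tail k))         ≡⟨ IsTailed.boxes t ⟩
           suc m                           ∎)
    = u , r , refl

  tailed-↔ : ∀ m → TailedBoxPath k (suc m) ↔ Reaching m 0
  tailed-↔ m = mk↔ₛ′ to from to∘from from∘to
    where
    encoded : ((w , p) : TailedBoxPath k (suc m)) → Σ (List Move) λ u → Reach m u 0 × w ≡ render u (tail k)
    encoded (w , p) = IsTailed⇒render m w (isTailedBoxPath⇒IsTailed (suc m) w p)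
    to : TailedBoxPath k (suc m) → Reaching m 0
    to x = proj₁ (encoded x) , proj₁ (proj₂ (encoded x))
    from : Reaching m 0 → TailedBoxPath k (suc m)
    from (u , r) = render u (tail k) , IsTailed⇒isTailedBoxPath (suc m) _ (render-IsTailed r)
    to∘from : ∀ y → to (from y) ≡ y
    to∘from (u , r) = proj₁-injective Reach-irrelevant
      (render-injective _ u (tail k) (sym (proj₂ (proj₂ (encoded (from (u , r)))))))
    from∘to : ∀ x → from (to x) ≡ x
    from∘to x = proj₁-injective (Decidable⇒UIP.≡-irrelevant Bool._≟_) (sym (proj₂ (proj₂ (encoded x))))

  Reaching-after-rise-↔ : ∀ h → Reaching 0 (suc h) ↔ Reaching 0 h
  Reaching-after-rise-↔ h = mk↔ₛ′ (λ { (_ , after-rise r) → _ , r }) (λ (u , r) → rise ∷ u , after-rise r)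
    (λ _ → refl) (λ { (_ , after-rise r) → refl })

  Reaching-after-fall-↔ : ∀ j → Reaching (suc j) 0 ↔ Reaching j (suc k + 0)
  Reaching-after-fall-↔ j = mk↔ₛ′ (λ { (_ , after-fall r) → _ , r }) (λ (u , r) → fall ∷ u , after-fall r)
    (λ _ → refl) (λ { (_ , after-fall r) → refl })

  Reaching-last-move-↔ : ∀ j h → Reaching (suc j) (suc h) ↔ (Reaching (suc j) h ⊎ Reaching j (suc k + suc h))
  Reaching-last-move-↔ j h = mk↔ₛ′ to from to∘from from∘to
    where
    to : Reaching (suc j) (suc h) → Reaching (suc j) h ⊎ Reaching j (suc k + suc h)
    to (_ , after-rise r) = inj₁ (_ , r)
    to (_ , after-fall r) = inj₂ (_ , r)
    from : Reaching (suc j) h ⊎ Reaching j (suc k + suc h) → Reaching (suc j) (suc h)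
    from (inj₁ (u , r)) = rise ∷ u , after-rise r
    from (inj₂ (u , r)) = fall ∷ u , after-fall r
    to∘from : ∀ y → to (from y) ≡ y
    to∘from (inj₁ _) = refl
    to∘from (inj₂ _) = refl
    from∘to : ∀ x → from (to x) ≡ x
    from∘to (_ , after-rise r) = refl
    from∘to (_ , after-fall r) = refl

  -- Read backwards, u is the Łukasiewicz code of a forest of h + 1 trees:
  -- a rise fills a slot with the empty tree, a fall fills it with a node opening 2 + k new slots.
  Reaching-↔ : ∀ j h → Reaching j h ↔ Fin (forests (2 + k) j (suc h))
  Reaching-↔ zero    zero    = mk↔ₛ′ (λ _ → zero) (λ _ → [] , start) (λ { zero → refl }) (λ { ([] , start) → refl })
  Reaching-↔ zero    (suc h) = ↔-trans (Reaching-after-rise-↔ h) (Reaching-↔ zero h)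
  Reaching-↔ (suc j) zero    = ↔-trans (Reaching-after-fall-↔ j) (Reaching-↔ j (suc k + 0))
  Reaching-↔ (suc j) (suc h) = ↔-trans (Reaching-last-move-↔ j h)
    (↔-trans (Reaching-↔ (suc j) h ⊎-↔ Reaching-↔ j (suc k + suc h)) (↔-sym +↔⊎))

  tailed-box-path-↔ : ∀ m → TailedBoxPath k (suc m) ↔ Fin (forests (2 + k) m 1)
  tailed-box-path-↔ m = ↔-trans (tailed-↔ m) (Reaching-↔ m 0)

proposition3p7 : (k n : ℕ) → 1 ≤ k → 1 ≤ n →
    Σ ℕ (λ N →
      (TailedBoxPath k n ↔ Fin N)
      × (MTreeOfSize (k + 2) (n ∸ 1) ↔ Fin N)
      × (N * ((k + 2) * (n ∸ 1) + 1) ≡ ((k + 2) * (n ∸ 1) + 1) C (n ∸ 1))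
      × (2 ≤ n → N * (n ∸ 1) ≡ ((k + 2) * (n ∸ 1)) C (n ∸ 2)))
proposition3p7 zero      _       ()
proposition3p7 (suc _)   zero    _ ()
proposition3p7 (suc k-1) (suc m) _ _ =
  forests (k + 2) m 1 ,
  subst (λ a → TailedBoxPath k (suc m) ↔ Fin (forests a m 1)) (+-comm 2 k) (tailed-box-path-↔ m) ,
  tree-↔ m ,
  trans (forests-closed (k-1 + 2) m 1) (*-identityˡ _) ,
  λ 2≤n → forests-closed-pred (k-1 + 2) (s≤s⁻¹ 2≤n)
  where open BoxPaths k-1
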